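{- Any nondeterministic finite transducer (NFT) with bounded trailing has an equivalent two-tape deterministic finite automaton (2DFA), i.e., a 2DFA $A$ with $L(A)=L(T)$.
   Context: A two-tape deterministic finite automaton (2DFA) is a tuple $A=(Q,\Sigma,\Gamma,\sqcup,\delta,q_0,F)$ with finite nonempty state set $Q$, finite nonempty input alphabet $\Sigma$ and output alphabet $\Gamma$, a blank (end-delimiter) symbol $\sqcup\notin\Sigma\cup\Gamma$, initial state $q_0$, accepting states $F\subseteq Q$, and a transition function $\delta\colon Q\times(\Sigma\cup\{\sqcup\})\times(\Gamma\cup\{\sqcup\})\to Q\times\{\mathrm{Stay},\mathrm{Advance}\}^2$, $(q,\sigma,\gamma)\mapsto(q',m_1,m_2)$, such that a head reading $\sqcup$ stays, and at least one head advances in each step. The automaton reads a word $a\in\Sigma^*$ on the input tape and $u\in\Gamma^*$ on the output tape (each followed by $\sqcup$) with one one-way head per tape; $(a,u)\in L(A)$ iff the computation ends, when both heads reach the blanks, in an accepting state. A nondeterministic finite transducer (NFT) is $T=(Q,\Sigma,\Gamma,\delta,q_0,F)$ where $\delta$ maps each $(q,\sigma)\in Q\times\Sigma$ to a finite subset of $Q\times\Gamma^*$; on each input symbol it moves to a new state and appends the chosen output word. We write $q\xrightarrow{a/u}q'$ if $T$ can go from $q$ to $q'$ reading $a$ and producing $u$. $L(T)$ is the set of pairs $(a,u)$ such that $q_0\xrightarrow{a/u}f$ for some $f\in F$. $T$ has bounded trailing if there is $t\in\mathbb{N}$ such that for all $q_1,q_2\in Q$, $f_1,f_2\in F$, $a,b_1,b_2\in\Sigma^*$,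 $u,v,w_1,w_2\in\Gamma^*$: if $q_0\xrightarrow{a/uv}q_1\xrightarrow{b_1/w_1}f_1$ and $q_0\xrightarrow{a/u}q_2\xrightarrow{b_2/vw_2}f_2$, then $|v|\le t$. -}

module Defs where

open import Data.Nat using (ℕ; suc; _≤_)
open import Data.Fin using (Fin)
open import Data.Bool using (Bool; true)
open import Data.Maybe using (Maybe; just; nothing)
open import Data.List using (List; []; _∷_; _++_; length)
open import Data.List.Membership.Propositional using (_∈_)
open import Data.Product using (Σ; _×_; _,_; ∃)
open import Data.Sum using (_⊎_)
open import Relation.Binary.PropositionalEquality using (_≡_; _≢_)
open import Relation.Nullary using (¬_)

-- Alphabets and state sets are finite nonempty sets Fin (suc k).
-- The blank symbol ⊔ is represented by 'nothing' in 'Maybe'.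

data Move : Set where
  Stay Advance : Move

headSym : {A : Set} → List A → Maybe A
headSym []      = nothing
headSym (x ∷ _) = just x

-- effect of a head move on the remaining (unread) part of a tape
move : {A : Set} → Move → List A → List A
move Stay    w       = w
move Advance []      = []
move Advance (_ ∷ w) = w

record 2DFA (s g : ℕ) : Set where
  field
    nQ     : ℕ
    q₀     : Fin (suc nQ)
    final  : Fin (suc nQ) → Bool
    δ      : Fin (suc nQ) → Maybe (Fin (suc s)) → Maybe (Fin (suc g))
             → Fin (suc nQ) × Move × Move
    blank₁ : ∀ q γ → Σ (Fin (suc nQ) × Move) λ p → δ q nothing γ ≡ (Data.Product.proj₁ p , Stay , Data.Product.proj₂ p)
    blank₂ : ∀ q σ → Σ (Fin (suc nQ) × Move) λ p → δ q σ nothing ≡ (Data.Product.proj₁ p , Data.Product.proj₂ p , Stay)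
    -- at least one head advances in each step (a step is only taken while
    -- not both heads are on the blanks; at that point the computation ends)
    progress : ∀ q σ γ → ¬ (σ ≡ nothing × γ ≡ nothing) → Σ (Fin (suc nQ)) λ q' → Σ Move λ m →
               (δ q σ γ ≡ (q' , Advance , m)) ⊎ (δ q σ γ ≡ (q' , m , Advance))

module _ {s g : ℕ} (A : 2DFA s g) where
  open 2DFA A

  data Run : Fin (suc nQ) → List (Fin (suc s)) → List (Fin (suc g)) → Fin (suc nQ) → Set where
    halt : ∀ {q} → Run q [] [] q
    step : ∀ {q a u q' m₁ m₂ qf} → ¬ (a ≡ [] × u ≡ []) →
           δ q (headSym a) (headSym u) ≡ (q' , m₁ , m₂) →
           Run q' (move m₁ a) (move m₂ u) qf →
           Run q a u qf

  L2 : List (Fin (suc s)) → List (Fin (suc g)) → Set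
  L2 a u = Σ (Fin (suc nQ)) λ qf → Run q₀ a u qf × final qf ≡ true

record NFT (s g : ℕ) : Set where
  field
    nQ    : ℕ
    q₀    : Fin (suc nQ)
    final : Fin (suc nQ) → Bool
    δ     : Fin (suc nQ) → Fin (suc s) → List (Fin (suc nQ) × List (Fin (suc g)))

module _ {s g : ℕ} (T : NFT s g) where
  open NFT T

  data Path : Fin (suc nQ) → List (Fin (suc s)) → List (Fin (suc g)) → Fin (suc nQ) → Set where
    ε    : ∀ {q} → Path q [] [] q
    _◅_  : ∀ {q σ q' v a u q''} → (q' , v) ∈ δ q σ → Path q' a u q'' → Path q (σ ∷ a) (v ++ u) q''

  LT : List (Fin (suc s)) → List (Fin (suc g)) → Set
  LT a u = Σ (Fin (suc nQ)) λ f → Path q₀ a u f × final f ≡ true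

  BoundedTrailing : Set
  BoundedTrailing = Σ ℕ λ t →
    ∀ {q₁ q₂ f₁ f₂ : Fin (suc nQ)} {a b₁ b₂ : List (Fin (suc s))}
      {u v w₁ w₂ : List (Fin (suc g))} →
    Path q₀ a (u ++ v) q₁ → Path q₁ b₁ w₁ f₁ → final f₁ ≡ true →
    Path q₀ a u q₂ → Path q₂ b₂ (v ++ w₂) f₂ → final f₂ ≡ true →
    length v ≤ t

module Submission where

-- The automaton runs a subset construction over configurations of T: a state of T paired with
-- the word by which the output guessed by T is ahead of, or behind, the part of the output tape
-- read so far. While neither tape is exhausted it reads the output tape exactly when some
-- configuration in its set is more than t symbols ahead and can still reach a final state, and
-- reads the input otherwise. Along an accepting run of T the tracked configuration is then at
-- most t ahead whenever input is read (else it would itself trigger output reading), and, by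
-- bounded trailing, at most t + m behind whenever output is read, m bounding the output of a
-- single transition. So buffers of length t + m + 1 suffice and the set of configurations is finite.

open import Defs
open import Data.Bool using (Bool; true; false; if_then_else_)
open import Data.Bool.Properties using () renaming (_≟_ to _≟ᵇ_)
open import Data.Empty using (⊥; ⊥-elim)
open import Data.Fin using (Fin; zero; suc; _↑ˡ_; _↑ʳ_; splitAt; punchIn; punchOut)
open import Data.Fin.Properties using (any?; splitAt-↑ˡ; splitAt-↑ʳ; punchIn-punchOut) renaming (_≟_ to _≟ᶠ_)
open import Data.Fin.Subset using (Subset)
open import Data.List using (List; []; _∷_; _++_; length; allFin; cartesianProduct; cartesianProductWith; concat; map; lookup)
open import Data.List.Extrema.Nat using (max; v≤max⁺)
open import Data.List.Membership.Propositional using (_∈_; find; lose)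
open import Data.List.Membership.Propositional.Properties
  using (∈-map⁺; ∈-++⁺ˡ; ∈-++⁺ʳ; ∈-concat⁺′; ∈-cartesianProduct⁺; ∈-cartesianProductWith⁺; ∈-allFin)
open import Data.List.Properties using (∷-injective; ++-assoc; ++-identityʳ; ++-cancelˡ; length-++; length-++-≤ˡ; length-++-≤ʳ)
import Data.List.Properties as List
open import Data.List.Relation.Unary.Any as Any using (Any; here; there; index)
open import Data.List.Relation.Unary.Any.Properties using (lookup-index)
open import Data.Maybe using (Maybe; just; nothing)
import Data.Maybe.Properties as Maybe
open import Data.Nat using (ℕ; zero; suc; _+_; _≤_; _<_; z≤n; s≤s; _≤?_)
open import Data.Nat.Properties
  using (≤-trans; ≤-reflexive; ≰⇒>; m≤m+n; m≤n+m; n≤1+n; n≮0; +-comm; +-mono-≤; +-monoˡ-≤; +-monoʳ-≤; +-assoc; +-cancelˡ-≤; module ≤-Reasoning)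
open import Data.Product using (Σ; ∃; ∃₂; _×_; _,_; proj₁; proj₂)
import Data.Product.Properties as Product
open import Data.Sum using (_⊎_; inj₁; inj₂; [_,_]′)
import Data.Sum.Properties as Sum
open import Data.Unit using (⊤)
open import Data.Vec using (Vec; []; _∷_; tabulate) renaming (lookup to lookupᵛ)
open import Data.Vec.Properties using (lookup∘tabulate)
open import Function using (_∘_)
open import Function.Bundles using (_⇔_; mk⇔)
open import Relation.Binary.Definitions using (DecidableEquality)
open import Relation.Binary.PropositionalEquality
open import Relation.Nullary using (Dec; yes; no; ¬_; does)
open import Relation.Nullary.Decidable using (_×-dec_; map′; dec-true)

dec-true⁻¹ : ∀ {a} {A : Set a} (a? : Dec A) → does a? ≡ true → A
dec-true⁻¹ (yes a) _ = a

levi : ∀ {A : Set} (xs ys zs ws : List A) → xs ++ ys ≡ zs ++ ws →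
       ∃ λ d → (xs ≡ zs ++ d × ws ≡ d ++ ys) ⊎ (zs ≡ xs ++ d × ys ≡ d ++ ws)
levi []       ys zs       ws eq = zs , inj₂ (refl , eq)
levi (x ∷ xs) ys []       ws eq = x ∷ xs , inj₁ (refl , sym eq)
levi (x ∷ xs) ys (z ∷ zs) ws eq with ∷-injective eq
... | refl , eq′ with levi xs ys zs ws eq′
...   | d , inj₁ (p , q) = d , inj₁ (cong (x ∷_) p , q)
...   | d , inj₂ (p , q) = d , inj₂ (cong (x ∷_) p , q)

words≤ : ∀ {n} → ℕ → List (List (Fin n))
words≤     zero    = [] ∷ []
words≤ {n} (suc k) = [] ∷ cartesianProductWith _∷_ (allFin n) (words≤ k)

∈-words≤ : ∀ {n k} (w : List (Fin n)) → length w ≤ k → w ∈ words≤ k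
∈-words≤ {k = zero}  []      _        = here refl
∈-words≤ {k = suc k} []      _        = here refl
∈-words≤ {k = suc k} (x ∷ w) (s≤s le) = there (∈-cartesianProductWith⁺ _∷_ (∈-allFin x) (∈-words≤ w le))

-- suc (codeBound K) = 2 ^ K
codeBound : ℕ → ℕ
codeBound zero    = zero
codeBound (suc K) = codeBound K + suc (codeBound K)

encode : ∀ {K} → Vec Bool K → Fin (suc (codeBound K))
encode         []           = zero
encode {suc K} (true  ∷ bs) = encode bs ↑ˡ suc (codeBound K)
encode {suc K} (false ∷ bs) = suc (codeBound K) ↑ʳ encode bs

decode : ∀ {K} → Fin (suc (codeBound K)) → Vec Bool K
decode {zero}  _ = []
decode {suc K} i with splitAt (suc (codeBound K)) i
... | inj₁ j = true  ∷ decode j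
... | inj₂ j = false ∷ decode j

decode-encode : ∀ {K} (bs : Vec Bool K) → decode (encode bs) ≡ bs
decode-encode [] = refl
decode-encode {suc K} (true ∷ bs)
  rewrite splitAt-↑ˡ (suc (codeBound K)) (encode bs) (suc (codeBound K)) = cong (true ∷_) (decode-encode bs)
decode-encode {suc K} (false ∷ bs)
  rewrite splitAt-↑ʳ (suc (codeBound K)) (suc (codeBound K)) (encode bs) = cong (false ∷_) (decode-encode bs)

data Reach {n} (E : Fin n → Fin n → Bool) (F : Fin n → Bool) : Fin n → Set where
  reached : ∀ {p} → F p ≡ true → Reach E F p
  via     : ∀ {p p′} → E p p′ ≡ true → Reach E F p′ → Reach E F p

module _ {m} (E : Fin (suc m) → Fin (suc m) → Bool) (F : Fin (suc m) → Bool) (q : Fin (suc m)) where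

  E∖ : Fin m → Fin m → Bool
  E∖ i j = E (punchIn q i) (punchIn q j)

  F∖ : Fin m → Bool
  F∖ = F ∘ punchIn q

  Reach-punchIn : ∀ {i} → Reach E∖ F∖ i → Reach E F (punchIn q i)
  Reach-punchIn (reached Fi) = reached Fi
  Reach-punchIn (via e r)    = via e (Reach-punchIn r)

  Reach-delete : ∀ {p} → Reach E F p →
    F q ≡ true ⊎ (∃ λ i → E q (punchIn q i) ≡ true × Reach E∖ F∖ i) ⊎ Σ (q ≢ p) (Reach E∖ F∖ ∘ punchOut)
  Reach-delete {p} (reached Fp) with q ≟ᶠ p
  ... | yes refl = inj₁ Fp
  ... | no q≢p   = inj₂ (inj₂ (q≢p , reached (subst (λ z → F z ≡ true) (sym (punchIn-punchOut q≢p)) Fp)))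
  Reach-delete {p} (via e r) with Reach-delete r
  ... | inj₁ Fq                  = inj₁ Fq
  ... | inj₂ (inj₁ leave)        = inj₂ (inj₁ leave)
  ... | inj₂ (inj₂ (q≢p′ , r′)) with q ≟ᶠ p
  ...   | yes refl = inj₂ (inj₁ (punchOut q≢p′ , subst (λ z → E q z ≡ true) (sym (punchIn-punchOut q≢p′)) e , r′))
  ...   | no q≢p   = inj₂ (inj₂ (q≢p , via (subst₂ (λ x y → E x y ≡ true)
                       (sym (punchIn-punchOut q≢p)) (sym (punchIn-punchOut q≢p′)) e) r′))

-- A path from q either stops at q or leaves q into the graph with q deleted.
reach? : ∀ {n} (E : Fin n → Fin n → Bool) (F : Fin n → Bool) q → Dec (Reach E F q)
reach? {suc m} E F q with F q ≟ᵇ true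
... | yes Fq = yes (reached Fq)
... | no ¬Fq with any? (λ i → (E q (punchIn q i) ≟ᵇ true) ×-dec reach? (E∖ E F q) (F∖ E F q) i)
...   | yes (i , e , r) = yes (via e (Reach-punchIn E F q r))
...   | no ¬leave       = no λ r → [ ¬Fq , [ ¬leave , (λ (q≢q , _) → q≢q refl) ]′ ]′ (Reach-delete E F q r)

module Buffers {A : Set} (_≟_ : DecidableEquality A) where

  Buffer : Set
  Buffer = List A ⊎ List A

  pattern ahead x  = inj₁ x
  pattern behind y = inj₂ y

  word : Buffer → List A
  word (ahead x)  = x
  word (behind y) = y

  _≟ᴮ_ : DecidableEquality Buffer
  _≟ᴮ_ = Sum.≡-dec (List.≡-dec _≟_) (List.≡-dec _≟_)

  Balance : (produced read : List A) → Buffer → Set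
  Balance o u (ahead x)  = o ≡ u ++ x
  Balance o u (behind y) = u ≡ o ++ y

  Balance-++ : ∀ w {o u} b → Balance o u b → Balance (w ++ o) (w ++ u) b
  Balance-++ w (ahead x)  refl = sym (++-assoc w _ x)
  Balance-++ w (behind y) refl = sym (++-assoc w _ y)

  Balance-cancel : ∀ w {o u} b → Balance (w ++ o) (w ++ u) b → Balance o u b
  Balance-cancel w {u = u} (ahead x)  eq = ++-cancelˡ w _ _ (trans eq (++-assoc w u x))
  Balance-cancel w {o = o} (behind y) eq = ++-cancelˡ w _ _ (trans eq (++-assoc w o y))

  Balance-≤ : ∀ {o u n} b → Balance o u b → length o ≤ n → length u ≤ n → length (word b) ≤ n
  Balance-≤ {u = u} (ahead x)  refl o≤n _   = ≤-trans (length-++-≤ʳ x {u}) o≤n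
  Balance-≤ {o = o} (behind y) refl _   u≤n = ≤-trans (length-++-≤ʳ y {o}) u≤n

  Balance-empty : ∀ {o u} b → Balance o u b → word b ≡ [] → o ≡ u
  Balance-empty (ahead _)  refl refl = ++-identityʳ _
  Balance-empty (behind _) refl refl = sym (++-identityʳ _)

  Balance-empty⁻ : ∀ {o u} b → Balance o u b → o ≡ u → word b ≡ []
  Balance-empty⁻ {u = u} (ahead x)  refl eq = ++-cancelˡ u x [] (trans eq (sym (++-identityʳ u)))
  Balance-empty⁻ {o = o} (behind y) refl eq = ++-cancelˡ o y [] (trans (sym eq) (sym (++-identityʳ o)))

  produce : Buffer → List A → Maybe Buffer
  produce (ahead x)        v       = just (ahead (x ++ v))
  produce (behind [])      v       = just (ahead v)
  produce (behind (c ∷ y)) []      = just (behind (c ∷ y))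
  produce (behind (c ∷ y)) (d ∷ v) with c ≟ d
  ... | yes _ = produce (behind y) v
  ... | no  _ = nothing

  consume : Buffer → A → Maybe Buffer
  consume (ahead [])      a = just (behind (a ∷ []))
  consume (ahead (c ∷ x)) a with c ≟ a
  ... | yes _ = just (ahead x)
  ... | no  _ = nothing
  consume (behind y)      a = just (behind (y ++ a ∷ []))

  produce-behind-sound : ∀ y v {b} → produce (behind y) v ≡ just b → Balance v y b
  produce-behind-sound []      v       refl = refl
  produce-behind-sound (c ∷ y) []      refl = refl
  produce-behind-sound (c ∷ y) (d ∷ v) eq with c ≟ d
  produce-behind-sound (c ∷ y) (c ∷ v) eq | yes refl = Balance-++ (c ∷ []) _ (produce-behind-sound y v eq)
  produce-behind-sound (c ∷ y) (d ∷ v) () | no _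

  produce-behind-complete : ∀ y v {r w} → v ++ r ≡ y ++ w → ∃ λ b → produce (behind y) v ≡ just b × Balance v y b
  produce-behind-complete []      v       _  = ahead v , refl , refl
  produce-behind-complete (c ∷ y) []      _  = behind (c ∷ y) , refl , refl
  produce-behind-complete (c ∷ y) (d ∷ v) eq with ∷-injective eq
  ... | refl , eq′ with c ≟ c
  ...   | no c≢c  = ⊥-elim (c≢c refl)
  ...   | yes refl with produce-behind-complete y v eq′
  ...     | b , eqb , bal = b , eqb , Balance-++ (c ∷ []) b bal

  consume-ahead-sound : ∀ x a {b} → consume (ahead x) a ≡ just b → Balance x (a ∷ []) b
  consume-ahead-sound []      a refl = refl
  consume-ahead-sound (c ∷ x) a eq with c ≟ a
  consume-ahead-sound (c ∷ x) c refl | yes refl = refl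
  consume-ahead-sound (c ∷ x) a ()   | no _

  consume-ahead-complete : ∀ x a {r w} → x ++ r ≡ a ∷ w → ∃ λ b → consume (ahead x) a ≡ just b × Balance x (a ∷ []) b
  consume-ahead-complete []      a _  = behind (a ∷ []) , refl , refl
  consume-ahead-complete (c ∷ x) a eq with ∷-injective eq
  ... | refl , _ with c ≟ c
  ...   | yes refl = ahead x , refl , refl
  ...   | no c≢c   = ⊥-elim (c≢c refl)

  produce-sound : ∀ {o u v b′} b → Balance o u b → produce b v ≡ just b′ → Balance (o ++ v) u b′
  produce-sound {u = u} {v} (ahead x)  refl refl = ++-assoc u x v
  produce-sound {o} {v = v} (behind y) refl eq = Balance-++ o _ (produce-behind-sound y v eq)

  produce-complete : ∀ {o u v r w} b → Balance o u b → o ++ v ++ r ≡ u ++ w →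
                     ∃ λ b′ → produce b v ≡ just b′ × Balance (o ++ v) u b′
  produce-complete {v = v} (ahead x) refl _ = ahead (x ++ v) , refl , ++-assoc _ x v
  produce-complete {o} {v = v} {r} {w} (behind y) refl eq
    with produce-behind-complete y v (++-cancelˡ o (v ++ r) (y ++ w) (trans eq (++-assoc o y w)))
  ... | b′ , eqb , bal = b′ , eqb , Balance-++ o b′ bal

  consume-sound : ∀ {o u a b′} b → Balance o u b → consume b a ≡ just b′ → Balance o (u ++ a ∷ []) b′
  consume-sound {u = u} {a} (ahead x)  refl eq   = Balance-++ u _ (consume-ahead-sound x a eq)
  consume-sound {o} {a = a} (behind y) refl refl = ++-assoc o y (a ∷ [])

  consume-complete : ∀ {o u a r w} b → Balance o u b → o ++ r ≡ u ++ a ∷ w →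
                     ∃ λ b′ → consume b a ≡ just b′ × Balance o (u ++ a ∷ []) b′
  consume-complete {u = u} {a} {r} {w} (ahead x) refl eq
    with consume-ahead-complete x a (++-cancelˡ u (x ++ r) (a ∷ w) (trans (sym (++-assoc u x r)) eq))
  ... | b′ , eqb , bal = b′ , eqb , Balance-++ u b′ bal
  consume-complete {o} {a = a} (behind y) refl _ = behind (y ++ a ∷ []) , refl , ++-assoc o y (a ∷ [])

module _ {s g : ℕ} (T : NFT s g) where
  open NFT T

  private
    Q  = Fin (suc nQ)
    Sy = Fin (suc s)
    Γ  = Fin (suc g)

  Path-++ : ∀ {q a w p b w′ r} → Path T q a w p → Path T p b w′ r → Path T q (a ++ b) (w ++ w′) r
  Path-++ ε                           P′ = P′
  Path-++ (_◅_ {v = v} {u = u} tr P) P′ = subst (λ z → Path T _ _ z _) (sym (++-assoc v u _)) (tr ◅ Path-++ P P′)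

  Path-snoc : ∀ {q a w p σ p′ v} → Path T q a w p → (p′ , v) ∈ δ p σ → Path T q (a ++ σ ∷ []) (w ++ v) p′
  Path-snoc {v = v} P tr = Path-++ P (subst (λ z → Path T _ _ z _) (++-identityʳ v) (tr ◅ ε))

  Path-split : ∀ {q} a₁ {a₂ w r} → Path T q (a₁ ++ a₂) w r →
               ∃₂ λ p w₁ → ∃ λ w₂ → Path T q a₁ w₁ p × Path T p a₂ w₂ r × w ≡ w₁ ++ w₂
  Path-split []       P = _ , [] , _ , ε , P , refl
  Path-split (σ ∷ a₁) (_◅_ {v = v} tr P) with Path-split a₁ P
  ... | p , w₁ , w₂ , P₁ , P₂ , refl = p , v ++ w₁ , w₂ , tr ◅ P₁ , P₂ , sym (++-assoc v w₁ w₂)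

  -- The transition whose output straddles the end of the output prefix.
  data Crossing (q : Q) : List Sy → List Γ → Q → Set where
    crossing-at : ∀ {a₁ σ a₂ p p′ r w₁ v w₂ d} →
      Path T q a₁ w₁ p → (p′ , v) ∈ δ p σ → Path T p′ a₂ w₂ r → length d ≤ length v →
      Crossing q (a₁ ++ σ ∷ a₂) (w₁ ++ d) r

  crossing : ∀ {q a w r} {u x : List Γ} → Path T q a w r → w ≡ u ++ x → x ≢ [] → Crossing q a u r
  crossing ε eq x≢[] = ⊥-elim (x≢[] (List.++-conicalʳ _ _ (sym eq)))
  crossing {u = u} {x} (_◅_ {v = v} {u = w} tr P) eq x≢[] with levi v w u x eq
  ... | d , inj₁ (refl , _) = crossing-at ε tr P (length-++-≤ˡ u)
  ... | d , inj₂ (refl , eq′) with crossing {u = d} P eq′ x≢[]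
  ...   | crossing-at {w₁ = w₁} {d = d′} P₁ tr′ P₂ d≤v =
          subst (λ z → Crossing _ _ z _) (++-assoc v w₁ d′) (crossing-at (tr ◅ P₁) tr′ P₂ d≤v)

  edge? : ∀ p p′ → Dec (∃ λ σ → Any (λ tr → proj₁ tr ≡ p′) (δ p σ))
  edge? p p′ = any? λ σ → Any.any? (λ tr → proj₁ tr ≟ᶠ p′) (δ p σ)

  Edge : Q → Q → Bool
  Edge p p′ = does (edge? p p′)

  CoReachable : Q → Set
  CoReachable = Reach Edge final

  Path⇒CoReachable : ∀ {p b w f} → Path T p b w f → final f ≡ true → CoReachable p
  Path⇒CoReachable ε                             Ff = reached Ff
  Path⇒CoReachable (_◅_ {σ = σ} tr P) Ff =
    via (dec-true (edge? _ _) (σ , lose tr refl)) (Path⇒CoReachable P Ff)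

  CoReachable⇒Path : ∀ {p} → CoReachable p → ∃₂ λ b w → ∃ λ f → Path T p b w f × final f ≡ true
  CoReachable⇒Path (reached Fp) = [] , [] , _ , ε , Fp
  CoReachable⇒Path {p} (via {p′ = p′} e r) with dec-true⁻¹ (edge? p p′) e
  ... | σ , σ-edge with find σ-edge | CoReachable⇒Path r
  ...   | (.p′ , v) , tr , refl | b , w , f , P , Ff = σ ∷ b , v ++ w , f , tr ◅ P , Ff

  private
    outputsAt : Q × Sy → List (List Γ)
    outputsAt (q , σ) = map proj₂ (δ q σ)

    outputs : List (List Γ)
    outputs = concat (map outputsAt (cartesianProduct (allFin _) (allFin _)))

  maxOutput : ℕ
  maxOutput = max 0 (map length outputs)

  maxOutput-≥ : ∀ {p σ p′ v} → (p′ , v) ∈ δ p σ → length v ≤ maxOutput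
  maxOutput-≥ {p} {σ} tr = v≤max⁺ 0 _ (inj₂ (Any.map ≤-reflexive (∈-map⁺ length
    (∈-concat⁺′ (∈-map⁺ proj₂ tr) (∈-map⁺ outputsAt (∈-cartesianProduct⁺ (∈-allFin p) (∈-allFin σ)))))))

  module _ (bt : BoundedTrailing T) where

    t : ℕ
    t = proj₁ bt

    trailing-bound : ∀ {a w p₁ b₁ w₁ f₁ o p₂ b₂ o₂ f₂ e} →
      Path T q₀ a w p₁ → Path T p₁ b₁ w₁ f₁ → final f₁ ≡ true →
      Path T q₀ a o p₂ → Path T p₂ b₂ o₂ f₂ → final f₂ ≡ true →
      w ++ e ≡ o ++ o₂ → length w ≤ length o + t
    trailing-bound {w = w} {o = o} {o₂ = o₂} {e = e} P₁ C₁ F₁ P₂ C₂ F₂ eq with levi w e o o₂ eq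
    ... | d , inj₁ (refl , refl) =
          subst (_≤ length o + t) (sym (length-++ o)) (+-monoʳ-≤ (length o) (proj₂ bt {u = o} {v = d} {w₂ = e} P₁ C₁ F₁ P₂ C₂ F₂))
    ... | d , inj₂ (refl , _) = ≤-trans (length-++-≤ˡ w) (m≤m+n _ t)

    -- Cut the second run at the input position of the transition where the first run's output
    -- crosses the end of ud; there the two runs are compared by bounded trailing.
    lag-bound : ∀ {ad ud x q b w f′ o p ar o′ f ur} →
      Path T q₀ ad (ud ++ x) q → x ≢ [] → Path T q b w f′ → final f′ ≡ true →
      Path T q₀ ad o p → Path T p ar o′ f → final f ≡ true → o ++ o′ ≡ ud ++ ur →
      length ud ≤ length o + (t + maxOutput)
    lag-bound {ud = ud} {o′ = o′} {ur = ur} Pd x≢[] Pc Fc Pρ Cρ Fρ agree with crossing {u = ud} Pd refl x≢[]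
    ... | crossing-at {a₁ = a₁} {w₁ = w₁} {d = d} P₁ tr P₂ d≤v with Path-split a₁ Pρ
    ...   | _ , o₁ , o₂ , Pρ₁ , Pρ₂ , refl = begin
      length (w₁ ++ d)                ≡⟨ length-++ w₁ ⟩
      length w₁ + length d            ≤⟨ +-mono-≤ w₁≤o₁+t (≤-trans d≤v (maxOutput-≥ tr)) ⟩
      length o₁ + t + maxOutput       ≡⟨ +-assoc (length o₁) t maxOutput ⟩
      length o₁ + (t + maxOutput)     ≤⟨ +-monoˡ-≤ (t + maxOutput) (length-++-≤ˡ o₁) ⟩
      length (o₁ ++ o₂) + (t + maxOutput) ∎
      where
        open ≤-Reasoning
        outputs-agree : w₁ ++ d ++ ur ≡ o₁ ++ o₂ ++ o′
        outputs-agree = trans (sym (++-assoc w₁ d ur)) (trans (sym agree) (++-assoc o₁ o₂ o′))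
        w₁≤o₁+t : length w₁ ≤ length o₁ + t
        w₁≤o₁+t = trailing-bound P₁ (Path-++ (tr ◅ P₂) Pc) Fc Pρ₁ (Path-++ Pρ₂ Cρ) Fρ outputs-agree

module Construction {s g : ℕ} (T : NFT s g) (bt : BoundedTrailing T) where
  open NFT T
  open Buffers (_≟ᶠ_ {suc g})

  private
    Q  = Fin (suc nQ)
    Sy = Fin (suc s)
    Γ  = Fin (suc g)
    t′ = t T bt
    m  = maxOutput T

  bufferBound : ℕ
  bufferBound = suc (t′ + m)

  Config : Set
  Config = Q × Buffer

  _≟ᶜ_ : DecidableEquality Config
  _≟ᶜ_ = Product.≡-dec _≟ᶠ_ _≟ᴮ_

  Bounded : Config → Set
  Bounded (_ , b) = length (word b) ≤ bufferBound

  opaque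
    configs : List Config
    configs = cartesianProduct (allFin _) (map ahead (words≤ bufferBound) ++ map behind (words≤ bufferBound))

    K : ℕ
    K = length configs

    config : Fin K → Config
    config = lookup configs

    config-onto : ∀ c → Bounded c → ∃ λ k → config k ≡ c
    config-onto (q , b) b≤ = index c∈ , sym (lookup-index c∈)
      where
        b∈ : ∀ b → length (word b) ≤ bufferBound → b ∈ map ahead (words≤ bufferBound) ++ map behind (words≤ bufferBound)
        b∈ (ahead x)  x≤ = ∈-++⁺ˡ (∈-map⁺ ahead (∈-words≤ x x≤))
        b∈ (behind y) y≤ = ∈-++⁺ʳ (map ahead (words≤ bufferBound)) (∈-map⁺ behind (∈-words≤ y y≤))
        c∈ : (q , b) ∈ configs
        c∈ = ∈-cartesianProduct⁺ (∈-allFin q) (b∈ b b≤)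

  State : Set
  State = Subset K

  record _∈ₛ_ (c : Config) (S : State) : Set where
    constructor at
    field
      position : Fin K
      named    : config position ≡ c
      selected : lookupᵛ S position ≡ true

  Has : State → (Config → Set) → Set
  Has S P = ∃ λ c → c ∈ₛ S × P c

  opaque
    has? : ∀ {P : Config → Set} → (∀ c → Dec (P c)) → ∀ S → Dec (Has S P)
    has? P? S = map′ (λ (k , Sk , Pk) → config k , at k refl Sk , Pk)
                     (λ { (_ , at k refl Sk , Pc) → k , Sk , Pc })
                     (any? λ k → (lookupᵛ S k ≟ᵇ true) ×-dec P? (config k))

  ｛_｝ : ∀ {P : Config → Set} → (∀ c → Dec (P c)) → State
  ｛ P? ｝ = tabulate (does ∘ P? ∘ config)

  ∈-｛｝⁻ : ∀ {P : Config → Set} (P? : ∀ c → Dec (P c)) {c} → c ∈ₛ ｛ P? ｝ → P c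
  ∈-｛｝⁻ P? (at k refl Sk) = dec-true⁻¹ (P? (config k)) (trans (sym (lookup∘tabulate _ k)) Sk)

  ∈-｛｝⁺ : ∀ {P : Config → Set} (P? : ∀ c → Dec (P c)) {c} → Bounded c → P c → c ∈ₛ ｛ P? ｝
  ∈-｛｝⁺ P? {c} c≤ Pc with config-onto c c≤
  ... | k , refl = at k refl (trans (lookup∘tabulate _ k) (dec-true (P? (config k)) Pc))

  Yields : Buffer → Config → Q × List Γ → Set
  Yields b (q′ , b′) (r , v) = r ≡ q′ × produce b v ≡ just b′

  InputMove : Sy → Config → Config → Set
  InputMove σ (q , b) c′ = Any (Yields b c′) (δ q σ)

  OutputMove : Γ → Config → Config → Set
  OutputMove γ (q , b) (q′ , b′) = q ≡ q′ × consume b γ ≡ just b′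

  inputMove? : ∀ σ c c′ → Dec (InputMove σ c c′)
  inputMove? σ (q , b) (q′ , b′) =
    Any.any? (λ (r , v) → (r ≟ᶠ q′) ×-dec Maybe.≡-dec _≟ᴮ_ (produce b v) (just b′)) (δ q σ)

  outputMove? : ∀ γ c c′ → Dec (OutputMove γ c c′)
  outputMove? γ (q , b) (q′ , b′) =
    (q ≟ᶠ q′) ×-dec Maybe.≡-dec _≟ᴮ_ (consume b γ) (just b′)

  inputSuccessor? : (σ : Sy) (S : State) → ∀ c′ → Dec (Has S λ c → InputMove σ c c′)
  inputSuccessor? σ S c′ = has? (λ c → inputMove? σ c c′) S

  outputSuccessor? : (γ : Γ) (S : State) → ∀ c′ → Dec (Has S λ c → OutputMove γ c c′)
  outputSuccessor? γ S c′ = has? (λ c → outputMove? γ c c′) S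

  readInput : Sy → State → State
  readInput σ S = ｛ inputSuccessor? σ S ｝

  readOutput : Γ → State → State
  readOutput γ S = ｛ outputSuccessor? γ S ｝

  isInitial? : ∀ c → Dec (c ≡ (q₀ , ahead []))
  isInitial? c = c ≟ᶜ (q₀ , ahead [])

  initial : State
  initial = ｛ isInitial? ｝

  Leading : Config → Set
  Leading (q , ahead x)  = t′ < length x × CoReachable T q
  Leading (q , behind _) = ⊥

  leading? : ∀ c → Dec (Leading c)
  leading? (q , ahead x)  = (suc t′ ≤? length x) ×-dec reach? (Edge T) final q
  leading? (q , behind _) = no λ ()

  Accepting : Config → Set
  Accepting (q , b) = final q ≡ true × word b ≡ []

  accepting? : ∀ c → Dec (Accepting c)
  accepting? (q , b) = (final q ≟ᵇ true) ×-dec List.≡-dec _≟ᶠ_ (word b) []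

  accepts : State → Bool
  accepts S = does (has? accepting? S)

  inputStep : State → Sy → State × Move × Move
  inputStep S σ = readInput σ S , Advance , Stay

  outputStep : State → Γ → State × Move × Move
  outputStep S γ = readOutput γ S , Stay , Advance

  δS : State → Maybe Sy → Maybe Γ → State × Move × Move
  δS S nothing  nothing  = S , Stay , Stay
  δS S (just σ) nothing  = inputStep S σ
  δS S nothing  (just γ) = outputStep S γ
  δS S (just σ) (just γ) = if does (has? leading? S) then outputStep S γ else inputStep S σ

  δS-both : ∀ S σ γ → (Has S Leading × δS S (just σ) (just γ) ≡ outputStep S γ)
                    ⊎ (¬ Has S Leading × δS S (just σ) (just γ) ≡ inputStep S σ)
  δS-both S σ γ with has? leading? S
  ... | yes lead = inj₁ (lead , refl)
  ... | no ¬lead = inj₂ (¬lead , refl)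

  δS-step : ∀ S a u → ¬ (a ≡ [] × u ≡ []) →
    (∃₂ λ σ a′ → a ≡ σ ∷ a′ × δS S (headSym a) (headSym u) ≡ inputStep S σ) ⊎
    (∃₂ λ γ u′ → u ≡ γ ∷ u′ × δS S (headSym a) (headSym u) ≡ outputStep S γ)
  δS-step S []      []      ne = ⊥-elim (ne (refl , refl))
  δS-step S (σ ∷ a) []      _  = inj₁ (σ , a , refl , refl)
  δS-step S []      (γ ∷ u) _  = inj₂ (γ , u , refl , refl)
  δS-step S (σ ∷ a) (γ ∷ u) _ with δS-both S σ γ
  ... | inj₁ (_ , eq) = inj₂ (γ , u , refl , eq)
  ... | inj₂ (_ , eq) = inj₁ (σ , a , refl , eq)

  Code : Set
  Code = Fin (suc (codeBound K))

  encodeStep : State × Move × Move → Code × Move × Move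
  encodeStep (S , m₁ , m₂) = encode S , m₁ , m₂

  automaton : 2DFA s g
  automaton = record
    { nQ       = codeBound K
    ; q₀       = encode initial
    ; final    = accepts ∘ decode
    ; δ        = λ f x y → encodeStep (δS (decode f) x y)
    ; blank₁   = blank₁
    ; blank₂   = blank₂
    ; progress = progress
    }
    where
      blank₁ : ∀ f γ → Σ (Code × Move) λ p → encodeStep (δS (decode f) nothing γ) ≡ (proj₁ p , Stay , proj₂ p)
      blank₁ f nothing  = _ , refl
      blank₁ f (just γ) = _ , refl

      blank₂ : ∀ f σ → Σ (Code × Move) λ p → encodeStep (δS (decode f) σ nothing) ≡ (proj₁ p , proj₂ p , Stay)
      blank₂ f nothing  = _ , refl
      blank₂ f (just σ) = _ , refl

      progress : ∀ f σ γ → ¬ (σ ≡ nothing × γ ≡ nothing) → Σ Code λ f′ → Σ Move λ m →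
                 (encodeStep (δS (decode f) σ γ) ≡ (f′ , Advance , m)) ⊎ (encodeStep (δS (decode f) σ γ) ≡ (f′ , m , Advance))
      progress f nothing  nothing  ne = ⊥-elim (ne (refl , refl))
      progress f (just σ) nothing  _  = _ , _ , inj₁ refl
      progress f nothing  (just γ) _  = _ , _ , inj₂ refl
      progress f (just σ) (just γ) _ with δS-both (decode f) σ γ
      ... | inj₁ (_ , eq) = _ , _ , inj₂ (cong encodeStep eq)
      ... | inj₂ (_ , eq) = _ , _ , inj₁ (cong encodeStep eq)

  Realised : List Sy → List Γ → Config → Set
  Realised ad ud (q , b) = ∃ λ o → Path T q₀ ad o q × Balance o ud b

  Sound : State → List Sy → List Γ → Set
  Sound S ad ud = ∀ {c} → c ∈ₛ S → Realised ad ud c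

  initial-sound : Sound initial [] []
  initial-sound c∈ with ∈-｛｝⁻ isInitial? c∈
  ... | refl = [] , ε , refl

  readInput-sound : ∀ {S ad ud σ} → Sound S ad ud → Sound (readInput σ S) (ad ++ σ ∷ []) ud
  readInput-sound {S} {σ = σ} sound {q′ , b′} c′∈ with ∈-｛｝⁻ (inputSuccessor? σ S) c′∈
  ... | (q , b) , c∈ , move with find move | sound c∈
  ...   | (.q′ , v) , tr , refl , eq | o , P , bal = o ++ v , Path-snoc T P tr , produce-sound b bal eq

  readOutput-sound : ∀ {S ad ud γ} → Sound S ad ud → Sound (readOutput γ S) ad (ud ++ γ ∷ [])
  readOutput-sound {S} {γ = γ} sound {q′ , b′} c′∈ with ∈-｛｝⁻ (outputSuccessor? γ S) c′∈
  ... | (.q′ , b) , c∈ , refl , eq with sound c∈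
  ...   | o , P , bal = o , P , consume-sound b bal eq

  decode-sound : ∀ {S ad ud} → Sound S ad ud → Sound (decode (encode S)) ad ud
  decode-sound {S} sound rewrite decode-encode S = sound

  accepts-sound : ∀ {S ad ud} → Sound S ad ud → accepts S ≡ true → LT T ad ud
  accepts-sound {S} sound acc with dec-true⁻¹ (has? accepting? S) acc
  ... | (q , b) , c∈ , Fq , empty with sound c∈
  ...   | o , P , bal = q , subst (λ w → Path T q₀ _ w q) (Balance-empty b bal empty) P , Fq

  sound : ∀ {f ar ur qf} → Run automaton f ar ur qf → ∀ {ad ud} → Sound (decode f) ad ud →
          accepts (decode qf) ≡ true → LT T (ad ++ ar) (ud ++ ur)
  sound halt {ad} {ud} s acc = subst₂ (LT T) (sym (++-identityʳ ad)) (sym (++-identityʳ ud)) (accepts-sound s acc)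
  sound {f} (step {a = ar} {u = ur} ne eq run) {ad} {ud} s acc with δS-step (decode f) ar ur ne
  ... | inj₁ (σ , ar′ , refl , eq′) with trans (sym (cong encodeStep eq′)) eq
  ...   | refl = subst (λ a → LT T a _) (++-assoc ad (σ ∷ []) ar′) (sound run (decode-sound (readInput-sound s)) acc)
  sound {f} (step {a = ar} {u = ur} ne eq run) {ad} {ud} s acc | inj₂ (γ , ur′ , refl , eq′)
    with trans (sym (cong encodeStep eq′)) eq
  ...   | refl = subst (λ u → LT T _ u) (++-assoc ud (γ ∷ []) ur′) (sound run (decode-sound (readOutput-sound s)) acc)

  record Tracking (S : State) (ad : List Sy) (ud : List Γ) (ar : List Sy) (ur : List Γ) : Set where
    constructor tracking
    field
      state end  : Q
      done todo  : List Γ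
      buffer     : Buffer
      prefix     : Path T q₀ ad done state
      suffix     : Path T state ar todo end
      accepted   : final end ≡ true
      agree      : done ++ todo ≡ ud ++ ur
      balance    : Balance done ud buffer
      bounded    : length (word buffer) ≤ bufferBound
      member     : (state , buffer) ∈ₛ S

  tracking-start : ∀ {a u} → LT T a u → Tracking initial [] [] a u
  tracking-start (f , ρ , Ff) = tracking q₀ f [] _ (ahead []) ε ρ Ff refl refl z≤n (∈-｛｝⁺ isInitial? z≤n refl)

  tracking-accepts : ∀ {S ad ud} → Tracking S ad ud [] [] → Has S Accepting
  tracking-accepts (tracking p _ o _ b _ ε Ff agree bal _ mem) =
    (p , b) , mem , Ff , Balance-empty⁻ b bal (trans (sym (++-identityʳ o)) (trans agree (++-identityʳ _)))

  ShortAhead : Buffer → Set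
  ShortAhead (ahead x)  = length x ≤ t′
  ShortAhead (behind _) = ⊤

  ShortBehind : Buffer → Set
  ShortBehind (ahead _)  = ⊤
  ShortBehind (behind y) = length y ≤ t′ + m

  produced-bound : ∀ {o ud v b′} b → Balance o ud b → ShortAhead b → length (word b) ≤ bufferBound →
                   length v ≤ m → produce b v ≡ just b′ → Balance (o ++ v) ud b′ → length (word b′) ≤ bufferBound
  produced-bound {v = v} (ahead x) _ x≤t _ v≤m refl _ =
    ≤-trans (≤-reflexive (length-++ x)) (≤-trans (+-mono-≤ x≤t v≤m) (n≤1+n _))
  produced-bound {o} {b′ = b′} (behind y) refl _ y≤ v≤m _ bal′ =
    Balance-≤ b′ (Balance-cancel o b′ bal′) (≤-trans v≤m (≤-trans (m≤n+m m t′) (n≤1+n _))) y≤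

  consumed-bound : ∀ {o ud γ b′} b → Balance o ud b → ShortBehind b → length (word b) ≤ bufferBound →
                   consume b γ ≡ just b′ → Balance o (ud ++ γ ∷ []) b′ → length (word b′) ≤ bufferBound
  consumed-bound {ud = ud} {b′ = b′} (ahead x) refl _ x≤ _ bal′ = Balance-≤ b′ (Balance-cancel ud b′ bal′) x≤ (s≤s z≤n)
  consumed-bound (behind y) _ y≤ _ refl _ = ≤-trans (≤-reflexive (trans (length-++ y) (+-comm (length y) 1))) (s≤s y≤)

  track-input : ∀ {S ad ud σ ar ur} (tr : Tracking S ad ud (σ ∷ ar) ur) → ShortAhead (Tracking.buffer tr) →
                Tracking (readInput σ S) (ad ++ σ ∷ []) ud ar ur
  track-input {S} {σ = σ} (tracking p f o _ b P (_◅_ {q' = p′} {v = v} {u = o′} tr P′) Ff agree bal b≤ mem) short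
    with produce-complete b bal agree
  ... | b′ , eq , bal′ = tracking p′ f (o ++ v) o′ b′ (Path-snoc T P tr) P′ Ff (trans (++-assoc o v o′) agree) bal′ b′≤
                           (∈-｛｝⁺ (inputSuccessor? σ S) b′≤ ((p , b) , mem , lose tr (refl , eq)))
    where
      b′≤ : length (word b′) ≤ bufferBound
      b′≤ = produced-bound b bal short b≤ (maxOutput-≥ T tr) eq bal′

  track-output : ∀ {S ad ud γ ar ur} (tr : Tracking S ad ud ar (γ ∷ ur)) → ShortBehind (Tracking.buffer tr) →
                 Tracking (readOutput γ S) ad (ud ++ γ ∷ []) ar ur
  track-output {S} {ud = ud} {γ} {ur = ur} (tracking p f o o′ b P P′ Ff agree bal b≤ mem) short
    with consume-complete b bal agree
  ... | b′ , eq , bal′ = tracking p f o o′ b′ P P′ Ff (trans agree (sym (++-assoc ud (γ ∷ []) ur))) bal′ b′≤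
                           (∈-｛｝⁺ (outputSuccessor? γ S) b′≤ ((p , b) , mem , refl , eq))
    where
      b′≤ : length (word b′) ≤ bufferBound
      b′≤ = consumed-bound b bal short b≤ eq bal′

  short-ahead-at-end : ∀ {S ad ud ar} (tr : Tracking S ad ud ar []) → ShortAhead (Tracking.buffer tr)
  short-ahead-at-end (tracking _ _ _ _ (behind _) _ _ _ _ _ _ _) = _
  short-ahead-at-end {ud = ud} (tracking _ _ _ o′ (ahead x) _ _ _ agree refl _ _)
    with List.++-conicalˡ x o′ (++-cancelˡ ud _ [] (trans (sym (++-assoc ud x o′)) agree))
  ... | refl = z≤n

  short-ahead-unless-leading : ∀ {S ad ud ar ur} → ¬ Has S Leading → (tr : Tracking S ad ud ar ur) →
                               ShortAhead (Tracking.buffer tr)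
  short-ahead-unless-leading _ (tracking _ _ _ _ (behind _) _ _ _ _ _ _ _) = _
  short-ahead-unless-leading ¬lead (tracking p _ _ _ (ahead x) _ P′ Ff _ _ _ mem) with length x ≤? t′
  ... | yes x≤t = x≤t
  ... | no  x≰t = ⊥-elim (¬lead ((p , ahead x) , mem , ≰⇒> x≰t , Path⇒CoReachable T P′ Ff))

  short-behind-at-end : ∀ {S ad ud γ ur} (tr : Tracking S ad ud [] (γ ∷ ur)) → ShortBehind (Tracking.buffer tr)
  short-behind-at-end (tracking _ _ _ _ (ahead _) _ _ _ _ _ _ _) = _
  short-behind-at-end {γ = γ} {ur} (tracking _ _ o _ (behind y) _ ε _ agree refl _ _)
    with List.++-conicalʳ y (γ ∷ ur) (sym (++-cancelˡ o [] _ (trans agree (++-assoc o y (γ ∷ ur)))))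
  ... | ()

  short-behind-if-leading : ∀ {S ad ud ar ur} → Sound S ad ud → Has S Leading → (tr : Tracking S ad ud ar ur) →
                            ShortBehind (Tracking.buffer tr)
  short-behind-if-leading _ _ (tracking _ _ _ _ (ahead _) _ _ _ _ _ _ _) = _
  short-behind-if-leading _ ((_ , behind _) , _ , ()) (tracking _ _ _ _ (behind _) _ _ _ _ _ _ _)
  short-behind-if-leading sound ((_ , ahead x) , c∈ , t<x , live) (tracking _ _ o _ (behind y) P P′ Ff agree refl _ _)
    with sound c∈ | CoReachable⇒Path T live
  ... | _ , Pd , refl | _ , _ , _ , Pc , Fc =
    +-cancelˡ-≤ (length o) _ _ (≤-trans (≤-reflexive (sym (length-++ o))) (lag-bound T bt Pd x≢[] Pc Fc P P′ Ff agree))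
    where
      x≢[] : x ≢ []
      x≢[] x≡[] = n≮0 (subst (λ z → t′ < length z) x≡[] t<x)

  AcceptingRun : State → List Sy → List Γ → Set
  AcceptingRun S a u = ∃ λ qf → Run automaton (encode S) a u qf × accepts (decode qf) ≡ true

  halt-run : ∀ {S} → Has S Accepting → AcceptingRun S [] []
  halt-run {S} acc = encode S , halt , subst (λ S′ → accepts S′ ≡ true) (sym (decode-encode S)) (dec-true (has? accepting? S) acc)

  step-run : ∀ {S S′ a u m₁ m₂} → ¬ (a ≡ [] × u ≡ []) → δS S (headSym a) (headSym u) ≡ (S′ , m₁ , m₂) →
             AcceptingRun S′ (move m₁ a) (move m₂ u) → AcceptingRun S a u
  step-run {S} {a = a} {u} ne eq (qf , run , acc) =
    qf , step ne (cong encodeStep (trans (cong (λ S₀ → δS S₀ (headSym a) (headSym u)) (decode-encode S)) eq)) run , acc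

  complete : ∀ {S ad ud} ar ur → Sound S ad ud → Tracking S ad ud ar ur → AcceptingRun S ar ur
  complete []       []       _ tr = halt-run (tracking-accepts tr)
  complete (σ ∷ ar) []       s tr =
    step-run (λ { (() , _) }) refl (complete ar [] (readInput-sound s) (track-input tr (short-ahead-at-end tr)))
  complete []       (γ ∷ ur) s tr =
    step-run (λ { (_ , ()) }) refl (complete [] ur (readOutput-sound s) (track-output tr (short-behind-at-end tr)))
  complete {S} (σ ∷ ar) (γ ∷ ur) s tr =
    [ (λ (lead , eq) → step-run (λ { (() , _) }) eq
        (complete (σ ∷ ar) ur (readOutput-sound s) (track-output tr (short-behind-if-leading s lead tr))))
    , (λ (¬lead , eq) → step-run (λ { (() , _) }) eq
        (complete ar (γ ∷ ur) (readInput-sound s) (track-input tr (short-ahead-unless-leading ¬lead tr))))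
    ]′ (δS-both S σ γ)

  L2⇔LT : ∀ a u → L2 automaton a u ⇔ LT T a u
  L2⇔LT a u = mk⇔ (λ (_ , run , acc) → sound run (decode-sound {initial} initial-sound) acc)
                  (λ acc → complete a u initial-sound (tracking-start acc))

theorem1 : ∀ {s g : ℕ} (T : NFT s g) → BoundedTrailing T →
           Σ (2DFA s g) λ A → ∀ (a : List (Fin (suc s))) (u : List (Fin (suc g))) →
           L2 A a u ⇔ LT T a u
theorem1 T bt = Construction.automaton T bt , Construction.L2⇔LT T bt
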